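{- Let $c\in(0,1/2]$ be a constant. Let $n,B,B_h\in\mathbb{N}$ with $n\ge B$ and $cB\le B_h\le B/2$, and let $f_j=1/j$ for $j\in[n]$. Let $h:[n]\setminus[B_h]\to[B-B_h]$ and $s:[n]\to\{ -1,1\}$ be independent, truly (uniformly) random hash functions. For $i\in[n]\setminus[B_h]$ define $\tilde f_i=\sum_{j=B_h+1}^{n}[h(j)=h(i)]\,s(j)\,f_j$. Then for every $i\in[n]\setminus[B_h]$, $\mathbb{E}[|\tilde f_i-s(i)f_i|]=\Theta(1/B)$, with implied constants depending only on $c$.
   Context: $[m]=\{1,\dots,m\}$ and $[E]$ denotes the indicator of event $E$.
   Formalization: The constant c ranges over the rationals in $(0,1/2]$. -}

module Defs where

open import Data.Bool using (Bool; true; false; if_then_else_)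
open import Data.Nat as ℕ using (ℕ; zero; suc)
open import Data.Fin using (Fin; zero; suc; toℕ; _↑ʳ_)
open import Data.Fin.Properties using () renaming (_≟_ to _≟F_)
open import Data.Integer using (+_; -[1+_])
open import Data.List using (List; []; _∷_; [_]; map; concatMap; length; foldr; allFin; cartesianProduct)
open import Data.Product using (_×_; _,_)
open import Data.Rational using (ℚ; 0ℚ; _+_; _*_; _-_; _/_; ∣_∣)
open import Relation.Nullary.Decidable using (⌊_⌋)

funs : ∀ {A : Set} (m : ℕ) → List A → List (Fin m → A)
funs zero    xs = [ (λ ()) ]
funs (suc m) xs =
  concatMap (λ x → map (λ g → λ { zero → x ; (suc i) → g i }) (funs m xs)) xs

allFuns : (m k : ℕ) → List (Fin m → Fin k)
allFuns m k = funs m (allFin k)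

sumℚ : List ℚ → ℚ
sumℚ = foldr _+_ 0ℚ

avg : List ℚ → ℚ
avg []       = 0ℚ
avg (x ∷ xs) = sumℚ (x ∷ xs) * ((+ 1) / suc (length xs))

-- expectation of X under the uniform distribution on a finite list of outcomes
𝔼 : {Ω : Set} → List Ω → (Ω → ℚ) → ℚ
𝔼 L X = avg (map X L)

sign : Bool → ℚ
sign true  = (+ 1) / 1
sign false = -[1+ 0 ] / 1

[_≡ᶠ_] : ∀ {k} → Fin k → Fin k → ℚ
[ a ≡ᶠ b ] = if ⌊ a ≟F b ⌋ then (+ 1) / 1 else 0ℚ

-- Setting: n = Bh + m.  Position j ∈ [n] (1-based) is the index (j-1) : Fin n.
-- Tail index k : Fin m stands for the element j = Bh + k + 1 of [n] \ [Bh].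
-- f_j = 1/j, so the tail element k has weight 1/(Bh + k + 1).
fTail : (Bh : ℕ) {m : ℕ} → Fin m → ℚ
fTail Bh k = (+ 1) / suc (Bh ℕ.+ toℕ k)

fTilde : (Bh m k : ℕ) → (Fin m → Fin k) → (Fin (Bh ℕ.+ m) → Bool) → Fin m → ℚ
fTilde Bh m k h s i =
  sumℚ (map (λ j → [ h j ≡ᶠ h i ] * (sign (s (Bh ↑ʳ j)) * fTail Bh j)) (allFin m))

expectedError : (B Bh m : ℕ) → Fin m → ℚ
expectedError B Bh m i =
  𝔼 (cartesianProduct (allFuns m (B ℕ.∸ Bh)) (funs (Bh ℕ.+ m) (true ∷ false ∷ [])))
    (λ { (h , s) → ∣ fTilde Bh m (B ℕ.∸ Bh) h s i - sign (s (Bh ↑ʳ i)) * fTail Bh i ∣ })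

module Submission where

-- Write K = B - Bh for the number of buckets.  The error is the random variable
-- X(h,s) = Σ_{j ≠ i} [h j = h i] s_j f_j over a uniform hash h : [m] → [K] and
-- uniform signs s.
--
-- Upper bound (ErrorAnalysis.upper-bound): E[X²] = (1/K) Σ_{j≠i} f_j²
-- ≤ 1/(K·Bh), and Cauchy–Schwarz gives (E|X|)² ≤ E[X²]; as B ≤ 2K and cB ≤ Bh
-- this is O(1/B²).  Lower bound (ErrorAnalysis.lower-bound): let t(h) count
-- the keys j < K (weight ≥ 1/B) other than i colliding with i.  When t ≥ 1,
-- flipping the sign of one of them shows E_s|X| ≥ 1/B; and [t ≥ 1] ≥ t - t²/4
-- with E t ≥ 1 - 1/K, E t² ≤ 2, so Pr[t ≥ 1] ≥ 1/4 for K ≥ 4.  The corollary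
-- follows with B₀ = 8, C₁ = 1/4 and C₂ = 1 + 2/c.

open import Defs
open import Data.Bool using (Bool; true; false; if_then_else_; T)
open import Data.Unit using (tt)
open import Data.Nat as ℕ using (ℕ; zero; suc; NonZero; _<ᵇ_)
import Data.Nat.Properties as ℕP
open import Data.Fin using (Fin; zero; suc; toℕ; _↑ʳ_; punchOut)
open import Data.Fin.Properties using (punchIn-punchOut; punchOut-injective; ↑ʳ-injective) renaming (_≟_ to _≟F_)
open import Data.Vec.Functional using (insertAt)
open import Data.Vec.Functional.Properties using (insertAt-lookup; insertAt-punchIn)
open import Data.Integer using (+_)
open import Data.List using (List; []; _∷_; map; concatMap; length; allFin; cartesianProduct; _++_; tabulate)
import Data.List.Properties as LP
open import Data.Rational using (ℚ; 0ℚ; 1ℚ; _+_; _*_; _-_; _/_; ∣_∣; -_; _≤_; _<_; 1/_; positive; nonNegative; >-nonZero)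
open import Data.Rational.Properties
import Data.Rational.Unnormalised as U
import Data.Rational.Unnormalised.Properties as UP
open import Data.Product using (Σ; _×_; _,_; proj₁; proj₂)
open import Data.Sum using (_⊎_; inj₁; inj₂)
open import Data.Empty using (⊥-elim)
open import Relation.Binary.PropositionalEquality
open import Relation.Nullary using (yes; no; ¬_; does)
open import Function using (_∘_; id)
import Data.Integer.Solver as ℤSolver
open import Data.Rational.Solver using (module +-*-Solver)

-- Natural numbers inside ℚ.  ι n = 1 + ⋯ + 1 is structurally recursive, which
-- makes it convenient for induction; fromℕ≡ι links it to (+ n) / 1.
ι : ℕ → ℚ
ι zero    = 0ℚ
ι (suc n) = 1ℚ + ι n

private
  fromℕ-suc : ∀ n → (+ suc n) / 1 ≡ 1ℚ + (+ n) / 1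
  fromℕ-suc n = toℚᵘ-injective (UP.≃-trans (toℚᵘ-fromℚᵘ (U.mkℚᵘ (+ suc n) 0))
    (UP.≃-trans (U.*≡* (solve 1 (λ x → (con (+ 1) :+ x) :* con (+ 1) := (con (+ 1) :+ x :* con (+ 1)) :* con (+ 1)) refl (+ n)))
    (UP.≃-sym (UP.≃-trans (toℚᵘ-homo-+ 1ℚ ((+ n) / 1)) (UP.+-congʳ U.1ℚᵘ (toℚᵘ-fromℚᵘ (U.mkℚᵘ (+ n) 0)))))))
    where open ℤSolver.+-*-Solver

  recip-fromℕ : ∀ n → ((+ 1) / suc n) * ((+ suc n) / 1) ≡ 1ℚ
  recip-fromℕ n = toℚᵘ-injective (UP.≃-trans (toℚᵘ-homo-* ((+ 1) / suc n) ((+ suc n) / 1))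
    (UP.≃-trans (UP.*-cong (toℚᵘ-fromℚᵘ (U.mkℚᵘ (+ 1) n)) (toℚᵘ-fromℚᵘ (U.mkℚᵘ (+ suc n) 0)))
    (U.*≡* (solve 1 (λ x → (con (+ 1) :* x) :* con (+ 1) := con (+ 1) :* (x :* con (+ 1))) refl (+ suc n)))))
    where open ℤSolver.+-*-Solver

fromℕ≡ι : ∀ n → (+ n) / 1 ≡ ι n
fromℕ≡ι zero    = refl
fromℕ≡ι (suc n) = trans (fromℕ-suc n) (cong (λ x → 1ℚ + x) (fromℕ≡ι n))

recip : ℕ → ℚ
recip n = (+ 1) / suc n

recip-ι : ∀ n → recip n * ι (suc n) ≡ 1ℚ
recip-ι n = trans (cong (recip n *_) (sym (fromℕ≡ι (suc n)))) (recip-fromℕ n)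

recip-pos : ∀ n → 0ℚ < recip n
recip-pos n = positive⁻¹ _ {{normalize-pos 1 (suc n)}}

ι-+ : ∀ a b → ι (a ℕ.+ b) ≡ ι a + ι b
ι-+ zero    b = sym (+-identityˡ (ι b))
ι-+ (suc a) b = trans (cong (λ x → 1ℚ + x) (ι-+ a b)) (sym (+-assoc 1ℚ (ι a) (ι b)))

ι-nonneg : ∀ a → 0ℚ ≤ ι a
ι-nonneg zero    = ≤-refl
ι-nonneg (suc a) = +-mono-≤ (<⇒≤ (positive⁻¹ 1ℚ)) (ι-nonneg a)

ι-mono : ∀ {a b} → a ℕ.≤ b → ι a ≤ ι b
ι-mono {zero}  {b}     _             = ι-nonneg b
ι-mono {suc a} {suc b} (ℕ.s≤s a≤b) = +-monoʳ-≤ 1ℚ (ι-mono a≤b)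

ι-pos : ∀ {a} → 1 ℕ.≤ a → 0ℚ < ι a
ι-pos {suc a} _ = <-≤-trans (positive⁻¹ 1ℚ) (≤-trans (≤-reflexive (sym (+-identityʳ 1ℚ))) (+-monoʳ-≤ 1ℚ (ι-nonneg a)))

*-nonneg : ∀ {a b} → 0ℚ ≤ a → 0ℚ ≤ b → 0ℚ ≤ a * b
*-nonneg {a} {b} 0≤a 0≤b = nonNegative⁻¹ (a * b) {{nonNeg*nonNeg⇒nonNeg a {{nonNegative 0≤a}} b {{nonNegative 0≤b}}}}

*-pos : ∀ {a b} → 0ℚ < a → 0ℚ < b → 0ℚ < a * b
*-pos {a} {b} 0<a 0<b = positive⁻¹ (a * b) {{pos*pos⇒pos a {{positive 0<a}} b {{positive 0<b}}}}

sq-nonneg : ∀ x → 0ℚ ≤ x * x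
sq-nonneg x with ≤-total 0ℚ x
... | inj₁ 0≤x = *-nonneg 0≤x 0≤x
... | inj₂ x≤0 = ≤-trans (*-nonneg (neg-antimono-≤ x≤0) (neg-antimono-≤ x≤0)) (≤-reflexive (neg*neg x))
  where
  neg*neg : ∀ x → (- x) * (- x) ≡ x * x
  neg*neg = solve 1 (λ x → (:- x) :* (:- x) := x :* x) refl
    where open +-*-Solver

∣x∣²≡x² : ∀ x → ∣ x ∣ * ∣ x ∣ ≡ x * x
∣x∣²≡x² x = trans (sym (∣p*q∣≡∣p∣*∣q∣ x x)) (0≤p⇒∣p∣≡p (sq-nonneg x))

0≤-⇒≤ : ∀ {a b} → 0ℚ ≤ b - a → a ≤ b
0≤-⇒≤ {a} {b} 0≤b-a = ≤-trans (≤-reflexive (sym (+-identityˡ a))) (≤-trans (+-monoˡ-≤ a 0≤b-a) (≤-reflexive (cancel a b)))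
  where
  cancel : ∀ a b → b - a + a ≡ b
  cancel = solve 2 (λ a b → b :- a :+ a := b) refl
    where open +-*-Solver

≤⇒0≤- : ∀ {a b} → a ≤ b → 0ℚ ≤ b - a
≤⇒0≤- {a} {b} a≤b = ≤-trans (≤-reflexive (sym (+-inverseʳ a))) (+-monoˡ-≤ (- a) a≤b)

sq-mono⁻¹ : ∀ {x C} → 0ℚ < C → x * x ≤ C * C → x ≤ C
sq-mono⁻¹ {x} {C} 0<C x²≤C² with x ≤? C
... | yes x≤C = x≤C
... | no  x≰C = ⊥-elim (<-irrefl refl (<-≤-trans C²<x² x²≤C²))
  where
  C<x : C < x
  C<x = ≰⇒> x≰C
  C²<x² : C * C < x * x
  C²<x² = ≤-<-trans (*-monoˡ-≤-nonNeg C {{nonNegative (<⇒≤ 0<C)}} (<⇒≤ C<x))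
                    (*-monoˡ-<-pos x {{positive (<-trans 0<C C<x)}} C<x)

∑ : ∀ {A : Set} → List A → (A → ℚ) → ℚ
∑ L F = sumℚ (map F L)

size : ∀ {A : Set} → List A → ℚ
size L = ∑ L (λ _ → 1ℚ)

module _ {A : Set} where

  ∑-cong : ∀ (L : List A) {F G : A → ℚ} → (∀ x → F x ≡ G x) → ∑ L F ≡ ∑ L G
  ∑-cong []      F≡G = refl
  ∑-cong (x ∷ L) F≡G = cong₂ _+_ (F≡G x) (∑-cong L F≡G)

  ∑-0 : ∀ (L : List A) → ∑ L (λ _ → 0ℚ) ≡ 0ℚ
  ∑-0 []      = refl
  ∑-0 (x ∷ L) = trans (+-identityˡ _) (∑-0 L)

  ∑-+ : ∀ (L : List A) (F G : A → ℚ) → ∑ L (λ x → F x + G x) ≡ ∑ L F + ∑ L G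
  ∑-+ []      F G = sym (+-identityˡ 0ℚ)
  ∑-+ (x ∷ L) F G = trans (cong (λ y → (F x + G x) + y) (∑-+ L F G)) (interchange (F x) (G x) (∑ L F) (∑ L G))
    where
    interchange : ∀ a b c d → (a + b) + (c + d) ≡ (a + c) + (b + d)
    interchange = solve 4 (λ a b c d → (a :+ b) :+ (c :+ d) := (a :+ c) :+ (b :+ d)) refl
      where open +-*-Solver

  ∑-*ˡ : ∀ (L : List A) (c : ℚ) (F : A → ℚ) → ∑ L (λ x → c * F x) ≡ c * ∑ L F
  ∑-*ˡ []      c F = sym (*-zeroʳ c)
  ∑-*ˡ (x ∷ L) c F = trans (cong (λ y → c * F x + y) (∑-*ˡ L c F)) (sym (*-distribˡ-+ c (F x) (∑ L F)))

  ∑-*ʳ : ∀ (L : List A) (c : ℚ) (F : A → ℚ) → ∑ L (λ x → F x * c) ≡ ∑ L F * c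
  ∑-*ʳ L c F = trans (∑-cong L (λ x → *-comm (F x) c)) (trans (∑-*ˡ L c F) (*-comm c (∑ L F)))

  ∑-neg : ∀ (L : List A) (F : A → ℚ) → ∑ L (λ x → - F x) ≡ - ∑ L F
  ∑-neg []      F = refl
  ∑-neg (x ∷ L) F = trans (cong (λ y → - F x + y) (∑-neg L F)) (sym (neg-distrib-+ (F x) (∑ L F)))

  ∑-const : ∀ (L : List A) (c : ℚ) → ∑ L (λ _ → c) ≡ size L * c
  ∑-const L c = trans (∑-cong L (λ _ → sym (*-identityˡ c))) (∑-*ʳ L c (λ _ → 1ℚ))

  size≡length : ∀ (L : List A) → size L ≡ ι (length L)
  size≡length []      = refl
  size≡length (x ∷ L) = cong (λ y → 1ℚ + y) (size≡length L)

  ∑-mono : ∀ (L : List A) {F G : A → ℚ} → (∀ x → F x ≤ G x) → ∑ L F ≤ ∑ L G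
  ∑-mono []      F≤G = ≤-refl
  ∑-mono (x ∷ L) F≤G = +-mono-≤ (F≤G x) (∑-mono L F≤G)

  ∑-nonneg : ∀ (L : List A) {F : A → ℚ} → (∀ x → 0ℚ ≤ F x) → 0ℚ ≤ ∑ L F
  ∑-nonneg L 0≤F = ≤-trans (≤-reflexive (sym (∑-0 L))) (∑-mono L 0≤F)

  size-nonneg : ∀ (L : List A) → 0ℚ ≤ size L
  size-nonneg L = ∑-nonneg L (λ _ → <⇒≤ (positive⁻¹ 1ℚ))

  ∑-++ : ∀ (L₁ L₂ : List A) (F : A → ℚ) → ∑ (L₁ ++ L₂) F ≡ ∑ L₁ F + ∑ L₂ F
  ∑-++ []       L₂ F = sym (+-identityˡ _)
  ∑-++ (x ∷ L₁) L₂ F = trans (cong (λ y → F x + y) (∑-++ L₁ L₂ F)) (sym (+-assoc (F x) _ _))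

  ∑-square : ∀ (L : List A) (u : A → ℚ) → ∑ L u * ∑ L u ≡ ∑ L (λ x → ∑ L (λ y → u x * u y))
  ∑-square L u = trans (sym (∑-*ʳ L (∑ L u) u)) (∑-cong L (λ x → sym (∑-*ˡ L (u x) u)))

  -- Cauchy–Schwarz, (Σ u)² ≤ |L| Σ u², from 0 ≤ Σ_{x,y} (u x - u y)² = 2(|L| Σ u² - (Σ u)²).
  cauchy-schwarz : ∀ (L : List A) (u : A → ℚ) → ∑ L u * ∑ L u ≤ size L * ∑ L (λ x → u x * u x)
  cauchy-schwarz L u =
    0≤-⇒≤ (*-cancelˡ-≤-pos 2ℚ (≤-trans (≤-reflexive (*-zeroʳ 2ℚ))
      (≤-trans (∑-nonneg L (λ x → ∑-nonneg L (λ y → sq-nonneg (u x - u y)))) (≤-reflexive spread))))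
    where
    open +-*-Solver
    2ℚ = 1ℚ + 1ℚ
    Σu = ∑ L u
    Σu² = ∑ L (λ x → u x * u x)
    expand : ∀ a b → (a - b) * (a - b) ≡ a * a + (b * b + (- 2ℚ) * (a * b))
    expand = solve 2 (λ a b → (a :- b) :* (a :- b) := a :* a :+ (b :* b :+ (:- (con 1ℚ :+ con 1ℚ)) :* (a :* b))) refl
    row : ∀ x → ∑ L (λ y → (u x - u y) * (u x - u y)) ≡ size L * (u x * u x) + (Σu² + (- 2ℚ) * (u x * Σu))
    row x = trans (∑-cong L (λ y → expand (u x) (u y)))
      (trans (∑-+ L (λ _ → u x * u x) _) (cong₂ _+_ (∑-const L (u x * u x)) (trans (∑-+ L (λ y → u y * u y) _)
        (cong (λ z → Σu² + z) (trans (∑-*ˡ L (- 2ℚ) _) (cong ((- 2ℚ) *_) (∑-*ˡ L (u x) u)))))))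
    collect : ∀ n q a → n * q + (n * q + (- 2ℚ) * (a * a)) ≡ 2ℚ * (n * q - a * a)
    collect = solve 3 (λ n q a → n :* q :+ (n :* q :+ (:- (con 1ℚ :+ con 1ℚ)) :* (a :* a)) := (con 1ℚ :+ con 1ℚ) :* (n :* q :- a :* a)) refl
    spread : ∑ L (λ x → ∑ L (λ y → (u x - u y) * (u x - u y))) ≡ 2ℚ * (size L * Σu² - Σu * Σu)
    spread = trans (∑-cong L row) (trans (∑-+ L (λ x → size L * (u x * u x)) _) (trans (cong₂ _+_ (∑-*ˡ L (size L) _)
      (trans (∑-+ L (λ _ → Σu²) _) (cong₂ _+_ (∑-const L Σu²) (trans (∑-*ˡ L (- 2ℚ) _) (cong ((- 2ℚ) *_) (∑-*ʳ L Σu u))))))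
      (collect (size L) Σu² Σu)))

  ∑-01 : ∀ (L : List A) (F : A → ℚ) → (∀ x → F x ≡ 0ℚ ⊎ F x ≡ 1ℚ) → ∑ L F ≡ 0ℚ ⊎ Σ A (λ x → F x ≡ 1ℚ)
  ∑-01 []      F F01 = inj₁ refl
  ∑-01 (x ∷ L) F F01 with F01 x
  ... | inj₂ Fx≡1 = inj₂ (x , Fx≡1)
  ... | inj₁ Fx≡0 with ∑-01 L F F01
  ...   | inj₂ witness = inj₂ witness
  ...   | inj₁ rest≡0  = inj₁ (cong₂ _+_ Fx≡0 rest≡0)

module _ {A B : Set} where

  ∑-map : ∀ (L : List A) (g : A → B) (F : B → ℚ) → ∑ (map g L) F ≡ ∑ L (λ x → F (g x))
  ∑-map []      g F = refl
  ∑-map (x ∷ L) g F = cong (λ y → F (g x) + y) (∑-map L g F)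

  ∑-concatMap : ∀ (L : List A) (G : A → List B) (F : B → ℚ) → ∑ (concatMap G L) F ≡ ∑ L (λ x → ∑ (G x) F)
  ∑-concatMap []      G F = refl
  ∑-concatMap (x ∷ L) G F = trans (∑-++ (G x) (concatMap G L) F) (cong (λ y → ∑ (G x) F + y) (∑-concatMap L G F))

  ∑-swap : ∀ (L₁ : List A) (L₂ : List B) (F : A → B → ℚ) →
           ∑ L₁ (λ x → ∑ L₂ (λ y → F x y)) ≡ ∑ L₂ (λ y → ∑ L₁ (λ x → F x y))
  ∑-swap []       L₂ F = sym (∑-0 L₂)
  ∑-swap (x ∷ L₁) L₂ F = trans (cong (λ z → ∑ L₂ (F x) + z) (∑-swap L₁ L₂ F)) (sym (∑-+ L₂ (F x) (λ y → ∑ L₁ (λ x' → F x' y))))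

module _ {A B : Set} where

  ∑-cartesian : ∀ (L₁ : List A) (L₂ : List B) (F : A × B → ℚ) →
                ∑ (cartesianProduct L₁ L₂) F ≡ ∑ L₁ (λ x → ∑ L₂ (λ y → F (x , y)))
  ∑-cartesian []       L₂ F = refl
  ∑-cartesian (x ∷ L₁) L₂ F = trans (∑-++ (map (x ,_) L₂) _ F) (cong₂ _+_ (∑-map L₂ (x ,_) F) (∑-cartesian L₁ L₂ F))

  size-cartesian : ∀ (L₁ : List A) (L₂ : List B) → size (cartesianProduct L₁ L₂) ≡ size L₁ * size L₂
  size-cartesian L₁ L₂ = trans (∑-cartesian L₁ L₂ (λ _ → 1ℚ)) (∑-const L₁ (size L₂))

avg*length≡sum : ∀ (ys : List ℚ) → avg ys * ι (length ys) ≡ sumℚ ys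
avg*length≡sum []       = refl
avg*length≡sum (x ∷ xs) = trans (*-assoc (sumℚ (x ∷ xs)) _ _) (trans (cong (sumℚ (x ∷ xs) *_) (recip-ι (length xs))) (*-identityʳ _))

𝔼*size≡∑ : ∀ {Ω : Set} (L : List Ω) (X : Ω → ℚ) → 𝔼 L X * size L ≡ ∑ L X
𝔼*size≡∑ L X = trans (cong (𝔼 L X *_) (trans (size≡length L) (cong ι (sym (LP.length-map X L))))) (avg*length≡sum (map X L))

∑-tabulate : ∀ {B : Set} n (f : Fin n → B) (F : B → ℚ) → ∑ (tabulate f) F ≡ ∑ (allFin n) (λ x → F (f x))
∑-tabulate zero    f F = refl
∑-tabulate (suc n) f F = cong (λ y → F (f zero) + y) (trans (∑-tabulate n (f ∘ suc) F) (sym (∑-tabulate n suc (λ x → F (f x)))))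

∑-allFin-suc : ∀ n (F : Fin (suc n) → ℚ) → ∑ (allFin (suc n)) F ≡ F zero + ∑ (allFin n) (λ x → F (suc x))
∑-allFin-suc n F = cong (λ y → F zero + y) (∑-tabulate n suc F)

size-allFin : ∀ n → size (allFin n) ≡ ι n
size-allFin n = trans (size≡length (allFin n)) (cong ι (LP.length-tabulate {n = n} id))

∑-initial-segment : ∀ m K → K ℕ.≤ m → ∑ (allFin m) (λ j → if toℕ j <ᵇ K then 1ℚ else 0ℚ) ≡ ι K
∑-initial-segment m       zero    _           = ∑-0 (allFin m)
∑-initial-segment (suc m) (suc K) (ℕ.s≤s K≤m) =
  trans (∑-allFin-suc m (λ j → if toℕ j <ᵇ suc K then 1ℚ else 0ℚ)) (cong (λ z → 1ℚ + z) (∑-initial-segment m K K≤m))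

[≡]-refl : ∀ {k} (a : Fin k) → [ a ≡ᶠ a ] ≡ 1ℚ
[≡]-refl a with a ≟F a
... | yes _   = refl
... | no  a≢a = ⊥-elim (a≢a refl)

[≡]-cases : ∀ {k} (a b : Fin k) → ([ a ≡ᶠ b ] ≡ 0ℚ × ¬ a ≡ b) ⊎ ([ a ≡ᶠ b ] ≡ 1ℚ × a ≡ b)
[≡]-cases a b with a ≟F b
... | yes a≡b = inj₂ (refl , a≡b)
... | no  a≢b = inj₁ (refl , a≢b)

[≡]-suc : ∀ {k} (x y : Fin k) → [ suc x ≡ᶠ suc y ] ≡ [ x ≡ᶠ y ]
[≡]-suc x y with x ≟F y
... | yes _ = refl
... | no  _ = refl

[≡]-nonneg : ∀ {k} (x y : Fin k) → 0ℚ ≤ [ x ≡ᶠ y ]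
[≡]-nonneg x y with [≡]-cases x y
... | inj₁ (≡0 , _) = ≤-reflexive (sym ≡0)
... | inj₂ (≡1 , _) = ≤-trans (<⇒≤ (positive⁻¹ 1ℚ)) (≤-reflexive (sym ≡1))

∑-δ : ∀ n (y : Fin n) (G : Fin n → ℚ) → ∑ (allFin n) (λ x → [ x ≡ᶠ y ] * G x) ≡ G y
∑-δ (suc n) zero G = trans (∑-allFin-suc n (λ x → [ x ≡ᶠ zero ] * G x))
  (trans (cong₂ _+_ (*-identityˡ (G zero)) (trans (∑-cong (allFin n) (λ x → *-zeroˡ (G (suc x)))) (∑-0 (allFin n))))
  (+-identityʳ (G zero)))
∑-δ (suc n) (suc y) G = trans (∑-allFin-suc n (λ x → [ x ≡ᶠ suc y ] * G x))
  (trans (cong₂ _+_ (*-zeroˡ (G zero)) (trans (∑-cong (allFin n) (λ x → cong (_* G (suc x)) ([≡]-suc x y))) (∑-δ n y (λ x → G (suc x)))))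
  (+-identityˡ _))

∑-δ₁ : ∀ n (y : Fin n) → ∑ (allFin n) (λ x → [ x ≡ᶠ y ]) ≡ 1ℚ
∑-δ₁ n y = trans (∑-cong (allFin n) (λ x → sym (*-identityʳ _))) (∑-δ n y (λ _ → 1ℚ))

-- A sum over xs^(m+1) splits
-- as a sum over the value x at any coordinate p and the remaining function g,
-- via insertAt g p x.  Without function extensionality we require the summand
-- to respect pointwise equality.
Extensional : ∀ {A : Set} {n} → ((Fin n → A) → ℚ) → Set
Extensional {A} {n} F = ∀ {g g' : Fin n → A} → (∀ q → g q ≡ g' q) → F g ≡ F g'

insertAt-cong : ∀ {A : Set} {n} {g g' : Fin n → A} (p : Fin (suc n)) (x : A) →
  (∀ q → g q ≡ g' q) → ∀ q → insertAt g p x q ≡ insertAt g' p x q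
insertAt-cong zero x g≗g' zero    = refl
insertAt-cong zero x g≗g' (suc q) = g≗g' q
insertAt-cong {n = suc n} (suc p) x g≗g' zero    = g≗g' zero
insertAt-cong {n = suc n} (suc p) x g≗g' (suc q) = insertAt-cong p x (λ k → g≗g' (suc k)) q

insertAt-other : ∀ {A : Set} {m} (g : Fin m → A) (p q : Fin (suc m)) (p≢q : ¬ p ≡ q) (x : A) →
  insertAt g p x q ≡ g (punchOut p≢q)
insertAt-other g p q p≢q x = trans (cong (insertAt g p x) (sym (punchIn-punchOut p≢q))) (insertAt-punchIn g p x (punchOut p≢q))

∑-funs-head : ∀ {A : Set} {m} (xs : List A) (F : (Fin (suc m) → A) → ℚ) → Extensional F →
  ∑ (funs (suc m) xs) F ≡ ∑ xs (λ x → ∑ (funs m xs) (λ g → F (insertAt g zero x)))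
∑-funs-head {m = m} xs F ext =
  trans (∑-concatMap xs _ F)
  (∑-cong xs (λ x → trans (∑-map (funs m xs) _ F) (∑-cong (funs m xs) (λ g → ext (λ { zero → refl ; (suc q) → refl })))))

∑-funs-at : ∀ {A : Set} {m} (xs : List A) (p : Fin (suc m)) (F : (Fin (suc m) → A) → ℚ) → Extensional F →
  ∑ (funs (suc m) xs) F ≡ ∑ xs (λ x → ∑ (funs m xs) (λ g → F (insertAt g p x)))
∑-funs-at xs zero F ext = ∑-funs-head xs F ext
∑-funs-at {m = suc m} xs (suc p) F ext =
  trans (∑-funs-head xs F ext)
  (trans (∑-cong xs (λ x₀ → ∑-funs-at xs p (λ g → F (insertAt g zero x₀)) (λ e → ext (insertAt-cong zero x₀ e))))
  (trans (∑-swap xs xs _)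
  (∑-cong xs (λ x → sym (trans (∑-funs-head xs (λ g → F (insertAt g (suc p) x)) (λ e → ext (insertAt-cong (suc p) x e)))
     (∑-cong xs (λ x₀ → ∑-cong (funs m xs) (λ g → ext (λ { zero → refl ; (suc q) → refl })))))))))

size-funs : ∀ {A : Set} {m} (xs : List A) → size (funs (suc m) xs) ≡ size xs * size (funs m xs)
size-funs {m = m} xs = trans (∑-funs-head xs (λ _ → 1ℚ) (λ _ → refl)) (∑-const xs (size (funs m xs)))

size-funs-pos : ∀ {A : Set} m (xs : List A) → 0ℚ < size xs → 0ℚ < size (funs m xs)
size-funs-pos zero    xs 0<xs = positive⁻¹ 1ℚ
size-funs-pos (suc m) xs 0<xs = <-≤-trans (*-pos 0<xs (size-funs-pos m xs 0<xs)) (≤-reflexive (sym (size-funs xs)))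

collision : ∀ {K m} (j i : Fin m) → ¬ j ≡ i →
  ∑ (allFuns m K) (λ h → [ h j ≡ᶠ h i ]) * ι K ≡ size (allFuns m K)
collision {K} {suc m} j i j≢i =
  trans (cong (_* ι K) (trans (∑-funs-at xs j (λ h → [ h j ≡ᶠ h i ]) (λ e → cong₂ [_≡ᶠ_] (e j) (e i)))
    (trans (∑-cong xs (λ x → ∑-cong G (λ g → cong₂ [_≡ᶠ_] (insertAt-lookup g j x) (insertAt-other g j i j≢i x))))
    (trans (∑-swap xs G _) (∑-cong G (λ g → ∑-δ₁ K (g (punchOut j≢i))))))))
  (trans (*-comm (size G) (ι K)) (sym (trans (size-funs xs) (cong (_* size G) (size-allFin K)))))
  where
  xs = allFin K
  G = funs m xs

collision₂ : ∀ {K m} (j l i : Fin m) → ¬ j ≡ i → ¬ j ≡ l → ¬ l ≡ i →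
  ∑ (allFuns m K) (λ h → [ h j ≡ᶠ h i ] * [ h l ≡ᶠ h i ]) * ι K * ι K ≡ size (allFuns m K)
collision₂ {K} {suc (suc m)} j l i j≢i j≢l l≢i =
  trans (cong (λ z → z * ι K * ι K) (trans (∑-funs-at xs j _ (λ e → cong₂ _*_ (cong₂ [_≡ᶠ_] (e j) (e i)) (cong₂ [_≡ᶠ_] (e l) (e i))))
    (trans (∑-cong xs (λ x → ∑-cong G (λ g → cong₂ _*_ (cong₂ [_≡ᶠ_] (insertAt-lookup g j x) (insertAt-other g j i j≢i x))
                                                     (cong₂ [_≡ᶠ_] (insertAt-other g j l j≢l x) (insertAt-other g j i j≢i x)))))
    (trans (∑-swap xs G _) (∑-cong G (λ g → trans (∑-*ʳ xs _ (λ x → [ x ≡ᶠ g i' ]))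
      (trans (cong (_* [ g l' ≡ᶠ g i' ]) (∑-δ₁ K (g i'))) (*-identityˡ _))))))))
  (trans (cong (_* ι K) (collision {K} l' i' (λ l'≡i' → l≢i (punchOut-injective j≢l j≢i l'≡i'))))
  (trans (*-comm (size G) (ι K)) (sym (trans (size-funs xs) (cong (_* size G) (size-allFin K))))))
  where
  xs = allFin K
  G = funs (suc m) xs
  i' = punchOut j≢i
  l' = punchOut j≢l
collision₂ {K} {suc zero} zero zero i j≢i j≢l l≢i = ⊥-elim (j≢l refl)

bits : List Bool
bits = true ∷ false ∷ []

IgnoresCoord : ∀ {n} → Fin n → ((Fin n → Bool) → ℚ) → Set
IgnoresCoord {n} p R = ∀ {s s' : Fin n → Bool} → (∀ q → ¬ q ≡ p → s q ≡ s' q) → R s ≡ R s'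

ignores-flip : ∀ {n} (p : Fin (suc n)) (R : (Fin (suc n) → Bool) → ℚ) → IgnoresCoord p R → ∀ g →
  R (insertAt g p false) ≡ R (insertAt g p true)
ignores-flip p R ignores g = ignores (λ q q≢p →
  trans (insertAt-other g p q (λ p≡q → q≢p (sym p≡q)) false) (sym (insertAt-other g p q (λ p≡q → q≢p (sym p≡q)) true)))

∑-signs-at : ∀ {n} (p : Fin (suc n)) (F : (Fin (suc n) → Bool) → ℚ) → Extensional F →
  ∑ (funs (suc n) bits) F ≡ ∑ (funs n bits) (λ g → F (insertAt g p true) + F (insertAt g p false))
∑-signs-at {n} p F ext = trans (∑-funs-at bits p F ext)
  (trans (cong (λ z → ∑ (funs n bits) (λ g → F (insertAt g p true)) + z) (+-identityʳ _))
  (sym (∑-+ (funs n bits) _ _)))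

sign-orthogonal : ∀ {n} (p : Fin n) (R : (Fin n → Bool) → ℚ) → IgnoresCoord p R →
  ∑ (funs n bits) (λ s → sign (s p) * R s) ≡ 0ℚ
sign-orthogonal {suc n} p R ignores =
  trans (∑-signs-at p _ (λ e → cong₂ _*_ (cong sign (e p)) (ignores (λ q _ → e q))))
  (trans (∑-cong (funs n bits) (λ g →
     trans (cong₂ (λ u v → sign u * R (insertAt g p true) + sign v * R (insertAt g p false)) (insertAt-lookup g p true) (insertAt-lookup g p false))
     (trans (cong (λ z → 1ℚ * R (insertAt g p true) + (- 1ℚ) * z) (ignores-flip p R ignores g)) (cancel (R (insertAt g p true))))))
  (∑-0 (funs n bits)))
  where
  cancel : ∀ r → 1ℚ * r + (- 1ℚ) * r ≡ 0ℚ
  cancel = solve 1 (λ r → con 1ℚ :* r :+ (:- con 1ℚ) :* r := con 0ℚ) refl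
    where open +-*-Solver

two-point-bound : ∀ a r → ∣ a ∣ + ∣ a ∣ ≤ ∣ a * 1ℚ + r ∣ + ∣ a * (- 1ℚ) + r ∣
two-point-bound a r = ≤-trans (≤-reflexive (sym (trans (cong ∣_∣ (difference a r)) (∣a+a∣ a))))
                              (∣p-q∣≤∣p∣+∣q∣ (a * 1ℚ + r) (a * (- 1ℚ) + r))
  where
  open +-*-Solver
  difference : ∀ a r → (a * 1ℚ + r) - (a * (- 1ℚ) + r) ≡ (1ℚ + 1ℚ) * a
  difference = solve 2 (λ a r → (a :* con 1ℚ :+ r) :- (a :* (:- con 1ℚ) :+ r) := (con 1ℚ :+ con 1ℚ) :* a) refl
  twice : ∀ a → (1ℚ + 1ℚ) * a ≡ a + a
  twice = solve 1 (λ a → (con 1ℚ :+ con 1ℚ) :* a := a :+ a) refl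
  ∣a+a∣ : ∀ a → ∣ (1ℚ + 1ℚ) * a ∣ ≡ ∣ a ∣ + ∣ a ∣
  ∣a+a∣ a = trans (∣p*q∣≡∣p∣*∣q∣ (1ℚ + 1ℚ) a) (twice ∣ a ∣)

sign-flip-bound : ∀ {n} (p : Fin n) (a : ℚ) (R : (Fin n → Bool) → ℚ) → IgnoresCoord p R →
  size (funs n bits) * ∣ a ∣ ≤ ∑ (funs n bits) (λ s → ∣ a * sign (s p) + R s ∣)
sign-flip-bound {suc n} p a R ignores = begin
  size (funs (suc n) bits) * ∣ a ∣
    ≡⟨ trans (cong (_* ∣ a ∣) (size-funs {m = n} bits)) (double (size S) ∣ a ∣) ⟩
  size S * (∣ a ∣ + ∣ a ∣)
    ≡⟨ ∑-const S (∣ a ∣ + ∣ a ∣) ⟨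
  ∑ S (λ _ → ∣ a ∣ + ∣ a ∣)
    ≤⟨ ∑-mono S (λ g → two-point-bound a (R₊ g)) ⟩
  ∑ S (λ g → ∣ a * 1ℚ + R₊ g ∣ + ∣ a * (- 1ℚ) + R₊ g ∣)
    ≡⟨ ∑-cong S pair ⟨
  ∑ S (λ g → F (insertAt g p true) + F (insertAt g p false))
    ≡⟨ ∑-signs-at p F (λ e → cong ∣_∣ (cong₂ _+_ (cong (λ b → a * sign b) (e p)) (ignores (λ q _ → e q)))) ⟨
  ∑ (funs (suc n) bits) F ∎
  where
  open ≤-Reasoning
  open +-*-Solver
  S = funs n bits
  F : (Fin (suc n) → Bool) → ℚ
  F s = ∣ a * sign (s p) + R s ∣
  R₊ : (Fin n → Bool) → ℚ
  R₊ g = R (insertAt g p true)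
  double : ∀ x y → (1ℚ + (1ℚ + 0ℚ)) * x * y ≡ x * (y + y)
  double = solve 2 (λ x y → (con 1ℚ :+ (con 1ℚ :+ con 0ℚ)) :* x :* y := x :* (y :+ y)) refl
  pair : ∀ g → F (insertAt g p true) + F (insertAt g p false) ≡ ∣ a * 1ℚ + R₊ g ∣ + ∣ a * (- 1ℚ) + R₊ g ∣
  pair g = trans (cong₂ (λ u v → ∣ a * sign u + R₊ g ∣ + ∣ a * sign v + R (insertAt g p false) ∣) (insertAt-lookup g p true) (insertAt-lookup g p false))
                 (cong (λ z → ∣ a * 1ℚ + R₊ g ∣ + ∣ a * (- 1ℚ) + z ∣) (ignores-flip p R ignores g))

-- 1/(n+2)² + 1/(n+2) ≤ 1/(n+1): with x = 1/(n+1), y = 1/(n+2) we have x = y + xy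
-- and y ≤ x, so y² + y ≤ xy + y = x.
recip-telescope : ∀ n → recip (suc n) * recip (suc n) + recip (suc n) ≤ recip n
recip-telescope n = ≤-trans (+-monoˡ-≤ y y²≤xy) (≤-reflexive (trans (+-comm (x * y) y) (sym x≡y+xy)))
  where
  open +-*-Solver
  x = recip n
  y = recip (suc n)
  expand : ∀ x y k → x * (y * (1ℚ + k)) ≡ x * y + y * (x * k)
  expand = solve 3 (λ x y k → x :* (y :* (con 1ℚ :+ k)) := x :* y :+ y :* (x :* k)) refl
  x≡y+xy : x ≡ y + x * y
  x≡y+xy = trans (sym (*-identityʳ x)) (trans (cong (x *_) (sym (recip-ι (suc n)))) (trans (expand x y (ι (suc n)))
    (trans (cong (λ z → x * y + y * z) (recip-ι n)) (trans (cong (λ z → x * y + z) (*-identityʳ y)) (+-comm (x * y) y)))))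
  y≤x : y ≤ x
  y≤x = ≤-trans (≤-reflexive (sym (+-identityʳ y)))
          (≤-trans (+-monoʳ-≤ y (*-nonneg (<⇒≤ (recip-pos n)) (<⇒≤ (recip-pos (suc n))))) (≤-reflexive (sym x≡y+xy)))
  y²≤xy : y * y ≤ x * y
  y²≤xy = *-monoʳ-≤-nonNeg y {{nonNegative (<⇒≤ (recip-pos (suc n)))}} y≤x

tail-squares : ∀ a m →
  ∑ (allFin m) (λ j → recip (suc a ℕ.+ toℕ j) * recip (suc a ℕ.+ toℕ j)) + recip (a ℕ.+ m) ≤ recip a
tail-squares a zero    = ≤-reflexive (trans (+-identityˡ _) (cong recip (ℕP.+-identityʳ a)))
tail-squares a (suc m) = begin
  ∑ (allFin (suc m)) (λ j → sq (suc a ℕ.+ toℕ j)) + recip (a ℕ.+ suc m)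
    ≡⟨ cong (_+ recip (a ℕ.+ suc m)) (∑-allFin-suc m (λ j → sq (suc a ℕ.+ toℕ j))) ⟩
  (sq (suc a ℕ.+ 0) + ∑ (allFin m) (λ j → sq (suc a ℕ.+ suc (toℕ j)))) + recip (a ℕ.+ suc m)
    ≡⟨ +-assoc (sq (suc a ℕ.+ 0)) _ _ ⟩
  sq (suc a ℕ.+ 0) + (∑ (allFin m) (λ j → sq (suc a ℕ.+ suc (toℕ j))) + recip (a ℕ.+ suc m))
    ≡⟨ cong₂ (λ u v → sq u + v) (ℕP.+-identityʳ (suc a))
         (cong₂ _+_ (∑-cong (allFin m) (λ j → cong sq (ℕP.+-suc (suc a) (toℕ j)))) (cong recip (ℕP.+-suc a m))) ⟩
  sq (suc a) + (∑ (allFin m) (λ j → sq (suc (suc a) ℕ.+ toℕ j)) + recip (suc a ℕ.+ m))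
    ≤⟨ +-monoʳ-≤ (sq (suc a)) (tail-squares (suc a) m) ⟩
  sq (suc a) + recip (suc a)
    ≤⟨ recip-telescope a ⟩
  recip a ∎
  where
  open ≤-Reasoning
  sq : ℕ → ℚ
  sq n = recip n * recip n

tail-energy : ∀ Bh → 1 ℕ.≤ Bh → ∀ m → ι Bh * ∑ (allFin m) (λ j → fTail Bh j * fTail Bh j) ≤ 1ℚ
tail-energy (suc a) _ m = begin
  ι (suc a) * Σf²                   ≤⟨ *-monoˡ-≤-nonNeg (ι (suc a)) {{nonNegative (ι-nonneg (suc a))}} Σf²≤ ⟩
  ι (suc a) * recip a               ≡⟨ *-comm (ι (suc a)) (recip a) ⟩
  recip a * ι (suc a)               ≡⟨ recip-ι a ⟩
  1ℚ ∎
  where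
  open ≤-Reasoning
  Σf² = ∑ (allFin m) (λ j → fTail (suc a) j * fTail (suc a) j)
  Σf²≤ : Σf² ≤ recip a
  Σf²≤ = ≤-trans (≤-trans (≤-reflexive (sym (+-identityʳ Σf²))) (+-monoʳ-≤ Σf² (<⇒≤ (recip-pos (a ℕ.+ m))))) (tail-squares a m)

¼ : ℚ
¼ = (+ 1) / 4

-- t - t²/4 ≤ 1 for every t, since 1 - t + t²/4 = (1 - t/2)².  For integers
-- t ≥ 0 this makes t - t²/4 a lower bound for the indicator [t ≥ 1].
t-¼t²≤1 : ∀ t → t - ¼ * (t * t) ≤ 1ℚ
t-¼t²≤1 t = 0≤-⇒≤ (≤-trans (sq-nonneg (1ℚ - ½ * t)) (≤-reflexive (square t)))
  where
  open +-*-Solver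
  ½ = (+ 1) / 2
  square : ∀ t → (1ℚ - ½ * t) * (1ℚ - ½ * t) ≡ 1ℚ - (t - ¼ * (t * t))
  square = solve 1 (λ t → (con 1ℚ :- con ½ :* t) :* (con 1ℚ :- con ½ :* t) := con 1ℚ :- (t :- con ¼ :* (t :* t))) refl

module ErrorAnalysis (B Bh m : ℕ) (i : Fin m) where

  K : ℕ
  K = B ℕ.∸ Bh

  keys : List (Fin m)
  keys = allFin m

  hashes : List (Fin m → Fin K)
  hashes = allFuns m K

  signings : List (Fin (Bh ℕ.+ m) → Bool)
  signings = funs (Bh ℕ.+ m) bits

  f : Fin m → ℚ
  f j = fTail Bh j

  σ : Fin m → (Fin (Bh ℕ.+ m) → Bool) → ℚ
  σ j s = sign (s (Bh ↑ʳ j))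

  d : Fin m → (Fin m → Fin K) → ℚ
  d j h = if does (j ≟F i) then 0ℚ else [ h j ≡ᶠ h i ]

  X : (Fin m → Fin K) → (Fin (Bh ℕ.+ m) → Bool) → ℚ
  X h s = ∑ keys (λ j → d j h * (σ j s * f j))

  X-eq : ∀ h s → fTilde Bh m K h s i - σ i s * f i ≡ X h s
  X-eq h s = trans (cong (_- σ i s * f i) (trans (∑-cong keys (λ j → split-i j (σ j s * f j)))
      (trans (∑-+ keys _ _) (cong (_+ X h s) (∑-δ m i (λ j → σ j s * f j))))))
    (cancel (σ i s * f i) (X h s))
    where
    split-i : ∀ j u → [ h j ≡ᶠ h i ] * u ≡ [ j ≡ᶠ i ] * u + d j h * u
    split-i j u with j ≟F i
    ... | yes refl = trans (cong (_* u) ([≡]-refl (h j))) (sym (trans (cong (λ z → 1ℚ * u + z) (*-zeroˡ u)) (+-identityʳ _)))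
    ... | no  _    = sym (trans (cong (_+ [ h j ≡ᶠ h i ] * u) (*-zeroˡ u)) (+-identityˡ _))
    cancel : ∀ a x → a + x - a ≡ x
    cancel = solve 2 (λ a x → a :+ x :- a := x) refl
      where open +-*-Solver

  d-cases : ∀ j h → (d j h ≡ 0ℚ) ⊎ (d j h ≡ 1ℚ × ¬ j ≡ i)
  d-cases j h with j ≟F i
  ... | yes _ = inj₁ refl
  ... | no j≢i with [≡]-cases (h j) (h i)
  ...   | inj₁ (≡0 , _) = inj₁ ≡0
  ...   | inj₂ (≡1 , _) = inj₂ (≡1 , j≢i)

  d-idem : ∀ j h → d j h * d j h ≡ d j h
  d-idem j h with d-cases j h
  ... | inj₁ ≡0       = trans (cong₂ _*_ ≡0 ≡0) (sym ≡0)
  ... | inj₂ (≡1 , _) = trans (cong₂ _*_ ≡1 ≡1) (sym ≡1)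

  d-other : ∀ j h → ¬ j ≡ i → d j h ≡ [ h j ≡ᶠ h i ]
  d-other j h j≢i with j ≟F i
  ... | yes j≡i = ⊥-elim (j≢i j≡i)
  ... | no  _   = refl

  d-self : ∀ h → d i h ≡ 0ℚ
  d-self h with i ≟F i
  ... | yes _   = refl
  ... | no  i≢i = ⊥-elim (i≢i refl)

  mean-d : ∀ j → ∑ hashes (d j) * ι K ≡ size hashes * (1ℚ - [ j ≡ᶠ i ])
  mean-d j with [≡]-cases j i
  ... | inj₁ (≡0 , j≢i) = trans (cong (_* ι K) (∑-cong hashes (λ h → d-other j h j≢i))) (trans (collision j i j≢i)
        (sym (trans (cong (λ z → size hashes * (1ℚ - z)) ≡0) (*-identityʳ (size hashes)))))
  ... | inj₂ (≡1 , refl) = trans (cong (_* ι K) (trans (∑-cong hashes d-self) (∑-0 hashes))) (trans (*-zeroˡ (ι K))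
        (sym (trans (cong (λ z → size hashes * (1ℚ - z)) ≡1) (*-zeroʳ (size hashes)))))

  sign-correlation : ∀ j l → ∑ signings (λ s → σ j s * σ l s) ≡ size signings * [ l ≡ᶠ j ]
  sign-correlation j l with [≡]-cases l j
  ... | inj₂ (≡1 , refl) = trans (∑-cong signings (λ s → sign² (s (Bh ↑ʳ j)))) (sym (trans (cong (size signings *_) ≡1) (*-identityʳ (size signings))))
    where
    sign² : ∀ b → sign b * sign b ≡ 1ℚ
    sign² true  = refl
    sign² false = refl
  ... | inj₁ (≡0 , l≢j) = trans (sign-orthogonal (Bh ↑ʳ j) (σ l) (λ s≗s' → cong sign (s≗s' (Bh ↑ʳ l) (λ eq → l≢j (↑ʳ-injective Bh l j eq)))))
        (sym (trans (cong (size signings *_) ≡0) (*-zeroʳ (size signings))))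

  -- E_s[X²] = Σ_j d_j f_j², by orthogonality of the signs.
  second-moment-signs : ∀ h → ∑ signings (λ s → X h s * X h s) ≡ size signings * ∑ keys (λ j → (d j h * f j) * (d j h * f j))
  second-moment-signs h =
    trans (∑-cong signings (λ s → trans (cong₂ _*_ (regroup s) (regroup s)) (∑-square keys (λ j → a j * σ j s))))
    (trans (∑-swap signings keys _)
    (trans (∑-cong keys (λ j → trans (∑-swap signings keys _) (trans (∑-cong keys (λ l → diagonal j l))
       (∑-δ m j (λ l → a j * a l * size signings)))))
    (trans (∑-*ʳ keys (size signings) (λ j → a j * a j)) (*-comm _ (size signings)))))
    where
    open +-*-Solver
    a : Fin m → ℚ
    a j = d j h * f j
    regroup : ∀ s → X h s ≡ ∑ keys (λ j → a j * σ j s)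
    regroup s = ∑-cong keys (λ j → solve 3 (λ x y z → x :* (y :* z) := (x :* z) :* y) refl (d j h) (σ j s) (f j))
    diagonal : ∀ j l → ∑ signings (λ s → (a j * σ j s) * (a l * σ l s)) ≡ [ l ≡ᶠ j ] * (a j * a l * size signings)
    diagonal j l = trans (∑-cong signings (λ s → solve 4 (λ x p y q → (x :* p) :* (y :* q) := (x :* y) :* (p :* q)) refl (a j) (σ j s) (a l) (σ l s)))
      (trans (∑-*ˡ signings (a j * a l) (λ s → σ j s * σ l s))
      (trans (cong (a j * a l *_) (sign-correlation j l))
             (solve 3 (λ x n y → x :* (n :* y) := y :* (x :* n)) refl (a j * a l) (size signings) [ l ≡ᶠ j ])))

  ∑f² : ℚ
  ∑f² = ∑ keys (λ j → f j * f j)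

  -- K · E[X²] ≤ Σ_j f_j²: each other key collides with i with probability 1/K.
  second-moment : ι K * ∑ hashes (λ h → ∑ signings (λ s → X h s * X h s)) ≤ size hashes * size signings * ∑f²
  second-moment = begin
    ι K * ∑ hashes (λ h → ∑ signings (λ s → X h s * X h s))
      ≡⟨ exact ⟩
    size signings * ∑ keys (λ j → size hashes * (1ℚ - [ j ≡ᶠ i ]) * (f j * f j))
      ≤⟨ *-monoˡ-≤-nonNeg (size signings) {{nonNegative (size-nonneg signings)}} (∑-mono keys drop-i) ⟩
    size signings * ∑ keys (λ j → size hashes * (f j * f j))
      ≡⟨ cong (size signings *_) (∑-*ˡ keys (size hashes) (λ j → f j * f j)) ⟩
    size signings * (size hashes * ∑f²)
      ≡⟨ solve 3 (λ s h q → s :* (h :* q) := h :* s :* q) refl (size signings) (size hashes) ∑f² ⟩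
    size hashes * size signings * ∑f² ∎
    where
    open ≤-Reasoning
    open +-*-Solver
    a² : ∀ j h → (d j h * f j) * (d j h * f j) ≡ d j h * (f j * f j)
    a² j h = trans (solve 2 (λ x y → (x :* y) :* (x :* y) := (x :* x) :* (y :* y)) refl (d j h) (f j)) (cong (_* (f j * f j)) (d-idem j h))
    exact : ι K * ∑ hashes (λ h → ∑ signings (λ s → X h s * X h s)) ≡ size signings * ∑ keys (λ j → size hashes * (1ℚ - [ j ≡ᶠ i ]) * (f j * f j))
    exact = begin-equality
      ι K * ∑ hashes (λ h → ∑ signings (λ s → X h s * X h s))
        ≡⟨ cong (ι K *_) (trans (∑-cong hashes second-moment-signs) (∑-*ˡ hashes (size signings) _)) ⟩
      ι K * (size signings * ∑ hashes (λ h → ∑ keys (λ j → (d j h * f j) * (d j h * f j))))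
        ≡⟨ cong (λ z → ι K * (size signings * z))
             (trans (∑-swap hashes keys _) (∑-cong keys (λ j → trans (∑-cong hashes (a² j)) (∑-*ʳ hashes (f j * f j) (d j))))) ⟩
      ι K * (size signings * ∑ keys (λ j → ∑ hashes (d j) * (f j * f j)))
        ≡⟨ solve 3 (λ k n s → k :* (n :* s) := n :* (k :* s)) refl (ι K) (size signings) _ ⟩
      size signings * (ι K * ∑ keys (λ j → ∑ hashes (d j) * (f j * f j)))
        ≡⟨ cong (size signings *_) (sym (∑-*ˡ keys (ι K) _)) ⟩
      size signings * ∑ keys (λ j → ι K * (∑ hashes (d j) * (f j * f j)))
        ≡⟨ cong (size signings *_) (∑-cong keys (λ j → trans (solve 3 (λ k x y → k :* (x :* y) := (x :* k) :* y) refl (ι K) (∑ hashes (d j)) (f j * f j))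
                                                              (cong (_* (f j * f j)) (mean-d j)))) ⟩
      size signings * ∑ keys (λ j → size hashes * (1ℚ - [ j ≡ᶠ i ]) * (f j * f j)) ∎
    drop-i : ∀ j → size hashes * (1ℚ - [ j ≡ᶠ i ]) * (f j * f j) ≤ size hashes * (f j * f j)
    drop-i j = ≤-trans (*-monoʳ-≤-nonNeg (f j * f j) {{nonNegative (sq-nonneg (f j))}}
                 (*-monoˡ-≤-nonNeg (size hashes) {{nonNegative (size-nonneg hashes)}}
                   (≤-trans (+-monoʳ-≤ 1ℚ (neg-antimono-≤ ([≡]-nonneg j i))) (≤-reflexive (+-identityʳ 1ℚ)))))
               (≤-reflexive (cong (_* (f j * f j)) (*-identityʳ (size hashes))))

  Ω : List ((Fin m → Fin K) × (Fin (Bh ℕ.+ m) → Bool))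
  Ω = cartesianProduct hashes signings

  absError : (Fin m → Fin K) × (Fin (Bh ℕ.+ m) → Bool) → ℚ
  absError (h , s) = ∣ fTilde Bh m K h s i - sign (s (Bh ↑ʳ i)) * fTail Bh i ∣

  N : ℚ
  N = size hashes * size signings

  E : ℚ
  E = expectedError B Bh m i

  ∑∣X∣ : ℚ
  ∑∣X∣ = ∑ hashes (λ h → ∑ signings (λ s → ∣ X h s ∣))

  ∑X² : ℚ
  ∑X² = ∑ hashes (λ h → ∑ signings (λ s → X h s * X h s))

  ∑-absError : ∑ Ω absError ≡ ∑∣X∣
  ∑-absError = trans (∑-cartesian hashes signings absError) (∑-cong hashes (λ h → ∑-cong signings (λ s → cong ∣_∣ (X-eq h s))))

  E-formula : E * N ≡ ∑∣X∣
  E-formula = trans (cong (E *_) (sym (size-cartesian hashes signings))) (trans (𝔼*size≡∑ Ω absError) ∑-absError)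

  N-pos : 1 ℕ.≤ K → 0ℚ < N
  N-pos 1≤K = *-pos (size-funs-pos m (allFin K) (<-≤-trans (ι-pos 1≤K) (≤-reflexive (sym (size-allFin K)))))
                    (size-funs-pos (Bh ℕ.+ m) bits (positive⁻¹ (1ℚ + (1ℚ + 0ℚ))))

  abs-moment≤second-moment : ∑∣X∣ * ∑∣X∣ ≤ N * ∑X²
  abs-moment≤second-moment = begin
    ∑∣X∣ * ∑∣X∣                                    ≡⟨ cong (λ z → z * z) ∑-absError ⟨
    ∑ Ω absError * ∑ Ω absError                     ≤⟨ cauchy-schwarz Ω absError ⟩
    size Ω * ∑ Ω (λ ω → absError ω * absError ω)    ≡⟨ cong₂ _*_ (size-cartesian hashes signings) ∑-absError² ⟩
    N * ∑X² ∎
    where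
    open ≤-Reasoning
    ∑-absError² : ∑ Ω (λ ω → absError ω * absError ω) ≡ ∑X²
    ∑-absError² = trans (∑-cartesian hashes signings (λ ω → absError ω * absError ω))
      (∑-cong hashes (λ h → ∑-cong signings (λ s → trans (cong (λ z → ∣ z ∣ * ∣ z ∣) (X-eq h s)) (∣x∣²≡x² (X h s)))))

  upper-bound : 1 ℕ.≤ Bh → 1 ℕ.≤ K → E * E * ι K * ι Bh ≤ 1ℚ
  upper-bound 1≤Bh 1≤K = *-cancelʳ-≤-pos (N * N) {{positive (*-pos (N-pos 1≤K) (N-pos 1≤K))}} (begin
    E * E * ι K * ι Bh * (N * N)      ≡⟨ solve 4 (λ e n k b → e :* e :* k :* b :* (n :* n) := (e :* n) :* (e :* n) :* (k :* b)) refl E N (ι K) (ι Bh) ⟩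
    (E * N) * (E * N) * (ι K * ι Bh)  ≡⟨ cong (λ z → z * z * (ι K * ι Bh)) E-formula ⟩
    ∑∣X∣ * ∑∣X∣ * (ι K * ι Bh)        ≤⟨ *-monoʳ-≤-nonNeg (ι K * ι Bh) {{nonNegative (*-nonneg (ι-nonneg K) (ι-nonneg Bh))}}
                                           abs-moment≤second-moment ⟩
    N * ∑X² * (ι K * ι Bh)            ≡⟨ solve 4 (λ n q k b → (n :* q) :* (k :* b) := (n :* b) :* (k :* q)) refl N ∑X² (ι K) (ι Bh) ⟩
    (N * ι Bh) * (ι K * ∑X²)          ≤⟨ *-monoˡ-≤-nonNeg (N * ι Bh) {{nonNegative (*-nonneg N≥0 (ι-nonneg Bh))}} second-moment ⟩
    (N * ι Bh) * (N * ∑f²)            ≡⟨ solve 3 (λ n b t → (n :* b) :* (n :* t) := (n :* n) :* (b :* t)) refl N (ι Bh) ∑f² ⟩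
    (N * N) * (ι Bh * ∑f²)            ≤⟨ *-monoˡ-≤-nonNeg (N * N) {{nonNegative (*-nonneg N≥0 N≥0)}} (tail-energy Bh 1≤Bh m) ⟩
    (N * N) * 1ℚ                      ≡⟨ *-comm (N * N) 1ℚ ⟩
    1ℚ * (N * N) ∎)
    where
    open ≤-Reasoning
    open +-*-Solver
    N≥0 : 0ℚ ≤ N
    N≥0 = <⇒≤ (N-pos 1≤K)

  -- Lower bound.  Call a key j "early" if toℕ j < K: then Bh + j + 1 ≤ B, so
  -- its weight is f_j ≥ 1/B.  t h counts the early keys j ≠ i colliding with i.
  early : Fin m → ℚ
  early j = if toℕ j <ᵇ K then 1ℚ else 0ℚ

  early-cases : ∀ j → (early j ≡ 0ℚ) ⊎ (early j ≡ 1ℚ × toℕ j ℕ.< K)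
  early-cases j with toℕ j <ᵇ K in eq
  ... | false = inj₁ refl
  ... | true  = inj₂ (refl , ℕP.<ᵇ⇒< (toℕ j) K (subst T (sym eq) tt))

  early-01 : ∀ j → 0ℚ ≤ early j × early j ≤ 1ℚ × early j * early j ≡ early j
  early-01 j with early-cases j
  ... | inj₁ ≡0       = subst (λ z → 0ℚ ≤ z × z ≤ 1ℚ × z * z ≡ z) (sym ≡0) (≤-refl , <⇒≤ (positive⁻¹ 1ℚ) , refl)
  ... | inj₂ (≡1 , _) = subst (λ z → 0ℚ ≤ z × z ≤ 1ℚ × z * z ≡ z) (sym ≡1) (<⇒≤ (positive⁻¹ 1ℚ) , ≤-refl , refl)

  weight-early : Bh ℕ.≤ B → ∀ j → toℕ j ℕ.< K → 1ℚ ≤ ι B * f j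
  weight-early Bh≤B j j<K = begin
    1ℚ                           ≡⟨ recip-ι (Bh ℕ.+ toℕ j) ⟨
    f j * ι (suc (Bh ℕ.+ toℕ j)) ≤⟨ *-monoˡ-≤-nonNeg (f j) {{nonNegative (<⇒≤ (recip-pos (Bh ℕ.+ toℕ j)))}} (ι-mono Bh+j<B) ⟩
    f j * ι B                    ≡⟨ *-comm (f j) (ι B) ⟩
    ι B * f j ∎
    where
    open ≤-Reasoning
    Bh+j<B : suc (Bh ℕ.+ toℕ j) ℕ.≤ B
    Bh+j<B = ℕP.≤-trans (ℕP.≤-reflexive (sym (ℕP.+-suc Bh (toℕ j))))
               (ℕP.≤-trans (ℕP.+-monoʳ-≤ Bh j<K) (ℕP.≤-reflexive (ℕP.m+[n∸m]≡n Bh≤B)))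

  earlyHit : Fin m → (Fin m → Fin K) → ℚ
  earlyHit j h = early j * d j h

  t : (Fin m → Fin K) → ℚ
  t h = ∑ keys (λ j → earlyHit j h)

  earlyHit-cases : ∀ j h → earlyHit j h ≡ 0ℚ ⊎ earlyHit j h ≡ 1ℚ
  earlyHit-cases j h with early-cases j | d-cases j h
  ... | inj₁ ≡0       | _             = inj₁ (trans (cong (_* d j h) ≡0) (*-zeroˡ (d j h)))
  ... | inj₂ (≡1 , _) | inj₁ ≡0'       = inj₁ (cong₂ _*_ ≡1 ≡0')
  ... | inj₂ (≡1 , _) | inj₂ (≡1' , _) = inj₂ (cong₂ _*_ ≡1 ≡1')

  earlyHit-one : ∀ j h → earlyHit j h ≡ 1ℚ → toℕ j ℕ.< K × d j h ≡ 1ℚ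
  earlyHit-one j h hit with early-cases j | d-cases j h
  ... | inj₁ ≡0        | _              = ⊥-elim (1≢0 (trans (sym hit) (trans (cong (_* d j h) ≡0) (*-zeroˡ (d j h)))))
  ... | inj₂ (≡1 , _)  | inj₁ ≡0'       = ⊥-elim (1≢0 (trans (sym hit) (cong₂ _*_ ≡1 ≡0')))
  ... | inj₂ (_ , j<K) | inj₂ (≡1' , _) = j<K , ≡1'

  rest : Fin m → (Fin m → Fin K) → (Fin (Bh ℕ.+ m) → Bool) → ℚ
  rest j₀ h s = ∑ keys (λ j → if does (j ≟F j₀) then 0ℚ else d j h * (σ j s * f j))

  X-split : ∀ j₀ h s → X h s ≡ (d j₀ h * f j₀) * σ j₀ s + rest j₀ h s
  X-split j₀ h s = trans (∑-cong keys (λ j → split j (d j h * (σ j s * f j))))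
    (trans (∑-+ keys (λ j → [ j ≡ᶠ j₀ ] * (d j h * (σ j s * f j))) (λ j → if does (j ≟F j₀) then 0ℚ else d j h * (σ j s * f j)))
    (cong (_+ rest j₀ h s) (trans (∑-δ m j₀ (λ j → d j h * (σ j s * f j)))
      (solve 3 (λ x y z → x :* (y :* z) := (x :* z) :* y) refl (d j₀ h) (σ j₀ s) (f j₀)))))
    where
    open +-*-Solver
    split : ∀ j u → u ≡ [ j ≡ᶠ j₀ ] * u + (if does (j ≟F j₀) then 0ℚ else u)
    split j u with j ≟F j₀
    ... | yes _ = sym (trans (+-identityʳ _) (*-identityˡ u))
    ... | no  _ = sym (trans (cong (_+ u) (*-zeroˡ u)) (+-identityˡ u))

  rest-ignores : ∀ j₀ h → IgnoresCoord (Bh ↑ʳ j₀) (rest j₀ h)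
  rest-ignores j₀ h {s} {s'} s≗s' = ∑-cong keys term
    where
    term : ∀ j → (if does (j ≟F j₀) then 0ℚ else d j h * (σ j s * f j)) ≡ (if does (j ≟F j₀) then 0ℚ else d j h * (σ j s' * f j))
    term j with j ≟F j₀
    ... | yes _   = refl
    ... | no  j≢j₀ = cong (λ b → d j h * (sign b * f j)) (s≗s' (Bh ↑ʳ j) (λ eq → j≢j₀ (↑ʳ-injective Bh j j₀ eq)))

  -- If t = 0 the left side is 0;
  -- otherwise some early key j₀ collides with i, and flipping its sign gives
  -- E_s|X| ≥ f_{j₀} ≥ 1/B ≥ (1/B)(t - t²/4).
  per-hash-lower : Bh ℕ.≤ B → ∀ h → size signings * (t h - ¼ * (t h * t h)) ≤ ι B * ∑ signings (λ s → ∣ X h s ∣)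
  per-hash-lower Bh≤B h with ∑-01 keys (λ j → earlyHit j h) (λ j → earlyHit-cases j h)
  ... | inj₁ t≡0 = begin
    size signings * (t h - ¼ * (t h * t h))  ≡⟨ cong (λ y → size signings * (y - ¼ * (y * y))) t≡0 ⟩
    size signings * 0ℚ                       ≡⟨ trans (*-zeroʳ (size signings)) (sym (*-zeroʳ (ι B))) ⟩
    ι B * 0ℚ                                 ≤⟨ *-monoˡ-≤-nonNeg (ι B) {{nonNegative (ι-nonneg B)}} (∑-nonneg signings (λ s → 0≤∣p∣ (X h s))) ⟩
    ι B * ∑ signings (λ s → ∣ X h s ∣) ∎
    where open ≤-Reasoning
  ... | inj₂ (j₀ , hit) with earlyHit-one j₀ h hit
  ...   | j₀<K , d≡1 = begin
    size signings * (t h - ¼ * (t h * t h))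
      ≤⟨ *-monoˡ-≤-nonNeg (size signings) {{Nₛ≥0}} (t-¼t²≤1 (t h)) ⟩
    size signings * 1ℚ
      ≤⟨ *-monoˡ-≤-nonNeg (size signings) {{Nₛ≥0}} (weight-early Bh≤B j₀ j₀<K) ⟩
    size signings * (ι B * f j₀)
      ≡⟨ solve 3 (λ n b x → n :* (b :* x) := b :* (n :* x)) refl (size signings) (ι B) (f j₀) ⟩
    ι B * (size signings * f j₀)
      ≡⟨ cong (λ z → ι B * (size signings * z)) ∣a∣≡f ⟨
    ι B * (size signings * ∣ a ∣)
      ≤⟨ *-monoˡ-≤-nonNeg (ι B) {{nonNegative (ι-nonneg B)}} (sign-flip-bound (Bh ↑ʳ j₀) a (rest j₀ h) (rest-ignores j₀ h)) ⟩
    ι B * ∑ signings (λ s → ∣ a * σ j₀ s + rest j₀ h s ∣)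
      ≡⟨ cong (ι B *_) (∑-cong signings (λ s → cong ∣_∣ (X-split j₀ h s))) ⟨
    ι B * ∑ signings (λ s → ∣ X h s ∣) ∎
    where
    open ≤-Reasoning
    open +-*-Solver
    Nₛ≥0 = nonNegative (size-nonneg signings)
    a = d j₀ h * f j₀
    ∣a∣≡f : ∣ a ∣ ≡ f j₀
    ∣a∣≡f = trans (cong ∣_∣ (trans (cong (_* f j₀) d≡1) (*-identityˡ (f j₀)))) (0≤p⇒∣p∣≡p (<⇒≤ (recip-pos (Bh ℕ.+ toℕ j₀))))

  mean-t : K ℕ.≤ m → ∑ hashes t * ι K ≡ size hashes * (ι K - early i)
  mean-t K≤m =
    trans (cong (_* ι K) (trans (∑-swap hashes keys _) (∑-cong keys (λ j → ∑-*ˡ hashes (early j) (d j)))))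
    (trans (sym (∑-*ʳ keys (ι K) _))
    (trans (∑-cong keys (λ j → trans (*-assoc (early j) _ _) (trans (cong (early j *_) (mean-d j)) (distribute (early j) (size hashes) [ j ≡ᶠ i ]))))
    (trans (∑-+ keys _ _) (trans (cong₂ _+_ (trans (∑-*ˡ keys (size hashes) early) (cong (size hashes *_) (∑-initial-segment m K K≤m)))
        (trans (∑-*ˡ keys (- size hashes) _) (cong (- size hashes *_) (∑-δ m i early))))
      (collect (size hashes) (ι K) (early i))))))
    where
    open +-*-Solver
    distribute : ∀ v n x → v * (n * (1ℚ - x)) ≡ n * v + (- n) * (x * v)
    distribute = solve 3 (λ v n x → v :* (n :* (con 1ℚ :- x)) := n :* v :+ (:- n) :* (x :* v)) refl
    collect : ∀ n k v → n * k + (- n) * v ≡ n * (k - v)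
    collect = solve 3 (λ n k v → n :* k :+ (:- n) :* v := n :* (k :- v)) refl

  -- The bound of pair-collisions holds trivially when one of the keys is i.
  vanishing : ∀ {x} (j l : Fin m) → x ≡ 0ℚ → x * ι K * ι K ≤ size hashes * (ι K * [ l ≡ᶠ j ] + 1ℚ)
  vanishing j l refl = ≤-trans (≤-reflexive (trans (cong (_* ι K) (*-zeroˡ (ι K))) (*-zeroˡ (ι K))))
    (*-nonneg (size-nonneg hashes) (+-mono-≤ (*-nonneg (ι-nonneg K) ([≡]-nonneg l j)) (<⇒≤ (positive⁻¹ 1ℚ))))

  pair-collisions : ∀ j l → ∑ hashes (λ h → d j h * d l h) * ι K * ι K ≤ size hashes * (ι K * [ l ≡ᶠ j ] + 1ℚ)
  pair-collisions j l with [≡]-cases j i | [≡]-cases l i | [≡]-cases l j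
  ... | inj₂ (_ , refl) | _ | _ = vanishing j l (trans (∑-cong hashes (λ h → trans (cong (_* d l h) (d-self h)) (*-zeroˡ (d l h)))) (∑-0 hashes))
  ... | inj₁ _ | inj₂ (_ , refl) | _ = vanishing j l (trans (∑-cong hashes (λ h → trans (cong (d j h *_) (d-self h)) (*-zeroʳ (d j h)))) (∑-0 hashes))
  ... | inj₁ (≡0 , _) | inj₁ _ | inj₂ (≡1 , refl) = begin
    ∑ hashes (λ h → d j h * d j h) * ι K * ι K  ≡⟨ cong (λ z → z * ι K * ι K) (∑-cong hashes (d-idem j)) ⟩
    ∑ hashes (d j) * ι K * ι K                  ≡⟨ cong (_* ι K) (trans (mean-d j)
                                                      (trans (cong (λ z → size hashes * (1ℚ - z)) ≡0) (*-identityʳ (size hashes)))) ⟩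
    size hashes * ι K                           ≤⟨ *-monoˡ-≤-nonNeg (size hashes) {{nonNegative (size-nonneg hashes)}} K≤K+1 ⟩
    size hashes * (ι K + 1ℚ)                    ≡⟨ cong (λ z → size hashes * (z + 1ℚ)) (trans (sym (*-identityʳ (ι K))) (cong (ι K *_) (sym ≡1))) ⟩
    size hashes * (ι K * [ j ≡ᶠ j ] + 1ℚ) ∎
    where
    open ≤-Reasoning
    K≤K+1 : ι K ≤ ι K + 1ℚ
    K≤K+1 = ≤-trans (≤-reflexive (sym (+-identityʳ (ι K)))) (+-monoʳ-≤ (ι K) (<⇒≤ (positive⁻¹ 1ℚ)))
  ... | inj₁ (_ , j≢i) | inj₁ (_ , l≢i) | inj₁ (≡0 , l≢j) = ≤-reflexive (begin
    ∑ hashes (λ h → d j h * d l h) * ι K * ι K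
      ≡⟨ cong (λ z → z * ι K * ι K) (∑-cong hashes (λ h → cong₂ _*_ (d-other j h j≢i) (d-other l h l≢i))) ⟩
    ∑ hashes (λ h → [ h j ≡ᶠ h i ] * [ h l ≡ᶠ h i ]) * ι K * ι K
      ≡⟨ collision₂ j l i j≢i (λ j≡l → l≢j (sym j≡l)) l≢i ⟩
    size hashes
      ≡⟨ trans (sym (*-identityʳ (size hashes))) (cong (size hashes *_) (sym (+-identityˡ 1ℚ))) ⟩
    size hashes * (0ℚ + 1ℚ)
      ≡⟨ cong (λ z → size hashes * (z + 1ℚ)) (trans (sym (*-zeroʳ (ι K))) (cong (ι K *_) (sym ≡0))) ⟩
    size hashes * (ι K * [ l ≡ᶠ j ] + 1ℚ) ∎)
    where open ≡-Reasoning

  -- Second moment of t: K² · E[t²] ≤ 2K², from E[d_j d_l] ≤ ([j = l] K + 1)/K²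
  -- summed over the K early keys j and l.
  second-moment-t : K ℕ.≤ m → ∑ hashes (λ h → t h * t h) * ι K * ι K ≤ size hashes * (ι K * ι K + ι K * ι K)
  second-moment-t K≤m = begin
    ∑ hashes (λ h → t h * t h) * k * k
      ≡⟨ expand ⟩
    ∑ keys (λ j → ∑ keys (λ l → (early j * early l) * (∑ hashes (λ h → d j h * d l h) * k * k)))
      ≤⟨ ∑-mono keys (λ j → ∑-mono keys (λ l → *-monoˡ-≤-nonNeg (early j * early l) {{nonNegative (ee≥0 j l)}} (pair-collisions j l))) ⟩
    ∑ keys (λ j → ∑ keys (λ l → (early j * early l) * (size hashes * (k * [ l ≡ᶠ j ] + 1ℚ))))
      ≡⟨ ∑-cong keys row ⟩
    ∑ keys (λ j → early j * (size hashes * k + k * size hashes))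
      ≡⟨ trans (∑-*ʳ keys _ early) (cong (_* (size hashes * k + k * size hashes)) (∑-initial-segment m K K≤m)) ⟩
    k * (size hashes * k + k * size hashes)
      ≡⟨ solve 2 (λ k n → k :* (n :* k :+ k :* n) := n :* (k :* k :+ k :* k)) refl k (size hashes) ⟩
    size hashes * (k * k + k * k) ∎
    where
    open ≤-Reasoning
    open +-*-Solver
    k = ι K
    ee≥0 : ∀ j l → 0ℚ ≤ early j * early l
    ee≥0 j l = *-nonneg (proj₁ (early-01 j)) (proj₁ (early-01 l))
    pull : (Y : Fin m → Fin m → ℚ) → ∑ keys (λ j → ∑ keys (Y j)) * k ≡ ∑ keys (λ j → ∑ keys (λ l → Y j l * k))
    pull Y = trans (sym (∑-*ʳ keys k (λ j → ∑ keys (Y j)))) (∑-cong keys (λ j → sym (∑-*ʳ keys k (Y j))))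
    W : Fin m → Fin m → ℚ
    W j l = (early j * early l) * ∑ hashes (λ h → d j h * d l h)
    t²-expand : ∑ hashes (λ h → t h * t h) ≡ ∑ keys (λ j → ∑ keys (λ l → W j l))
    t²-expand = trans (∑-cong hashes (λ h → ∑-square keys (λ j → earlyHit j h)))
      (trans (∑-swap hashes keys _) (∑-cong keys (λ j → trans (∑-swap hashes keys _) (∑-cong keys (λ l →
        trans (∑-cong hashes (λ h → solve 4 (λ a b c d → (a :* c) :* (b :* d) := (a :* b) :* (c :* d)) refl (early j) (early l) (d j h) (d l h)))
              (∑-*ˡ hashes (early j * early l) (λ h → d j h * d l h)))))))
    expand : ∑ hashes (λ h → t h * t h) * k * k ≡ ∑ keys (λ j → ∑ keys (λ l → (early j * early l) * (∑ hashes (λ h → d j h * d l h) * k * k)))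
    expand = trans (cong (λ z → z * k * k) t²-expand) (trans (cong (_* k) (pull W)) (trans (pull (λ j l → W j l * k))
      (∑-cong keys (λ j → ∑-cong keys (λ l → solve 3 (λ w s k → w :* s :* k :* k := w :* (s :* k :* k))
                                                  refl (early j * early l) (∑ hashes (λ h → d j h * d l h)) k)))))
    -- Summing over l: the diagonal term contributes k, the others 1 each.
    row : ∀ j → ∑ keys (λ l → (early j * early l) * (size hashes * (k * [ l ≡ᶠ j ] + 1ℚ))) ≡ early j * (size hashes * k + k * size hashes)
    row j = begin-equality
      ∑ keys (λ l → (early j * early l) * (size hashes * (k * [ l ≡ᶠ j ] + 1ℚ)))
        ≡⟨ ∑-cong keys (λ l → solve 5 (λ k a b n x → (a :* b) :* (n :* (k :* x :+ con 1ℚ)) := x :* (a :* b :* n :* k) :+ a :* (b :* n))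
                                        refl k (early j) (early l) (size hashes) [ l ≡ᶠ j ]) ⟩
      ∑ keys (λ l → [ l ≡ᶠ j ] * (early j * early l * size hashes * k) + early j * (early l * size hashes))
        ≡⟨ ∑-+ keys _ _ ⟩
      ∑ keys (λ l → [ l ≡ᶠ j ] * (early j * early l * size hashes * k)) + ∑ keys (λ l → early j * (early l * size hashes))
        ≡⟨ cong₂ _+_ (∑-δ m j (λ l → early j * early l * size hashes * k)) (∑-*ˡ keys (early j) (λ l → early l * size hashes)) ⟩
      early j * early j * size hashes * k + early j * ∑ keys (λ l → early l * size hashes)
        ≡⟨ cong₂ (λ u v → u * size hashes * k + early j * v) (proj₂ (proj₂ (early-01 j)))
                 (trans (∑-*ʳ keys (size hashes) early) (cong (_* size hashes) (∑-initial-segment m K K≤m))) ⟩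
      early j * size hashes * k + early j * (k * size hashes)
        ≡⟨ solve 3 (λ k a n → a :* n :* k :+ a :* (k :* n) := a :* (n :* k :+ k :* n)) refl k (early j) (size hashes) ⟩
      early j * (size hashes * k + k * size hashes) ∎

  -- E[t - t²/4] ≥ 1/4 when K ≥ 4, because E t ≥ 1 - 1/K and E t² ≤ 2:
  -- K(E[t - t²/4] - 1/4) = (1 - early i) + (K/4)(2 - E t²) + (K - 4)/4 ≥ 0.
  indicator-lower : K ℕ.≤ m → 4 ℕ.≤ K → ¼ * size hashes ≤ ∑ hashes (λ h → t h - ¼ * (t h * t h))
  indicator-lower K≤m 4≤K = *-cancelˡ-≤-pos k {{positive 0<k}} (0≤-⇒≤ (≤-trans nonneg (≤-reflexive (sym identity))))
    where
    open ≤-Reasoning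
    open +-*-Solver
    k = ι K
    0<k : 0ℚ < k
    0<k = <-≤-trans (positive⁻¹ (ι 4)) (ι-mono 4≤K)
    Nₕ = size hashes
    Σt = ∑ hashes t
    Σt² = ∑ hashes (λ h → t h * t h)
    Σt²≤2N : Σt² ≤ Nₕ + Nₕ
    Σt²≤2N = *-cancelʳ-≤-pos (k * k) {{positive (*-pos 0<k 0<k)}} (≤-trans (≤-reflexive (sym (*-assoc Σt² k k)))
               (≤-trans (second-moment-t K≤m) (≤-reflexive (solve 2 (λ n k → n :* (k :* k :+ k :* k) := (n :+ n) :* (k :* k)) refl Nₕ k))))
    linearity : ∑ hashes (λ h → t h - ¼ * (t h * t h)) ≡ Σt - ¼ * Σt²
    linearity = trans (∑-+ hashes t (λ h → - (¼ * (t h * t h)))) (cong (λ z → Σt + z)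
                  (trans (∑-neg hashes (λ h → ¼ * (t h * t h))) (cong -_ (∑-*ˡ hashes ¼ (λ h → t h * t h)))))
    identity : k * ∑ hashes (λ h → t h - ¼ * (t h * t h)) - k * (¼ * Nₕ) ≡ Nₕ * (1ℚ - early i) + ¼ * k * ((Nₕ + Nₕ) - Σt²) + ¼ * Nₕ * (k - ι 4)
    identity = begin-equality
      k * ∑ hashes (λ h → t h - ¼ * (t h * t h)) - k * (¼ * Nₕ)
        ≡⟨ cong (λ z → k * z - k * (¼ * Nₕ)) linearity ⟩
      k * (Σt - ¼ * Σt²) - k * (¼ * Nₕ)
        ≡⟨ solve 4 (λ k St Stt n → k :* (St :- con ¼ :* Stt) :- k :* (con ¼ :* n) := St :* k :- con ¼ :* k :* Stt :- k :* con ¼ :* n)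
                   refl k Σt Σt² Nₕ ⟩
      Σt * k - ¼ * k * Σt² - k * ¼ * Nₕ
        ≡⟨ cong (λ z → z - ¼ * k * Σt² - k * ¼ * Nₕ) (mean-t K≤m) ⟩
      Nₕ * (k - early i) - ¼ * k * Σt² - k * ¼ * Nₕ
        ≡⟨ solve 4 (λ k v Stt n → n :* (k :- v) :- con ¼ :* k :* Stt :- k :* con ¼ :* n
                                := n :* (con 1ℚ :- v) :+ con ¼ :* k :* ((n :+ n) :- Stt) :+ con ¼ :* n :* (k :- con (ι 4)))
                   refl k (early i) Σt² Nₕ ⟩
      Nₕ * (1ℚ - early i) + ¼ * k * ((Nₕ + Nₕ) - Σt²) + ¼ * Nₕ * (k - ι 4) ∎
    ¼≥0 : 0ℚ ≤ ¼
    ¼≥0 = <⇒≤ (positive⁻¹ ¼)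
    nonneg : 0ℚ ≤ Nₕ * (1ℚ - early i) + ¼ * k * ((Nₕ + Nₕ) - Σt²) + ¼ * Nₕ * (k - ι 4)
    nonneg = +-mono-≤ (+-mono-≤ (*-nonneg (size-nonneg hashes) (≤⇒0≤- (proj₁ (proj₂ (early-01 i)))))
                                (*-nonneg (*-nonneg ¼≥0 (<⇒≤ 0<k)) (≤⇒0≤- Σt²≤2N)))
                      (*-nonneg (*-nonneg ¼≥0 (size-nonneg hashes)) (≤⇒0≤- (ι-mono 4≤K)))

  lower-bound : Bh ℕ.≤ B → K ℕ.≤ m → 4 ℕ.≤ K → ¼ ≤ ι B * E
  lower-bound Bh≤B K≤m 4≤K = *-cancelʳ-≤-pos N {{positive (N-pos (ℕP.≤-trans (ℕ.s≤s ℕ.z≤n) 4≤K))}} (begin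
    ¼ * N
      ≡⟨ solve 3 (λ a q b → q :* (b :* a) := a :* (q :* b)) refl (size signings) ¼ (size hashes) ⟩
    size signings * (¼ * size hashes)
      ≤⟨ *-monoˡ-≤-nonNeg (size signings) {{nonNegative (size-nonneg signings)}} (indicator-lower K≤m 4≤K) ⟩
    size signings * ∑ hashes (λ h → t h - ¼ * (t h * t h))
      ≡⟨ ∑-*ˡ hashes (size signings) _ ⟨
    ∑ hashes (λ h → size signings * (t h - ¼ * (t h * t h)))
      ≤⟨ ∑-mono hashes (per-hash-lower Bh≤B) ⟩
    ∑ hashes (λ h → ι B * ∑ signings (λ s → ∣ X h s ∣))
      ≡⟨ ∑-*ˡ hashes (ι B) _ ⟩
    ι B * ∑∣X∣
      ≡⟨ trans (cong (ι B *_) (sym E-formula)) (sym (*-assoc (ι B) E N)) ⟩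
    ι B * E * N ∎)
    where
    open ≤-Reasoning
    open +-*-Solver

module Parameters {B Bh : ℕ} (2Bh≤B : 2 ℕ.* Bh ℕ.≤ B) where

  Bh≤B : Bh ℕ.≤ B
  Bh≤B = ℕP.≤-trans (ℕP.m≤m+n Bh (Bh ℕ.+ 0)) 2Bh≤B

  B≤2K : B ℕ.≤ (B ℕ.∸ Bh) ℕ.+ (B ℕ.∸ Bh)
  B≤2K = ℕP.≤-trans (ℕP.≤-reflexive (sym (ℕP.m+[n∸m]≡n Bh≤B))) (ℕP.+-monoˡ-≤ (B ℕ.∸ Bh) Bh≤K)
    where
    Bh≤K : Bh ℕ.≤ B ℕ.∸ Bh
    Bh≤K = ℕP.+-cancelˡ-≤ Bh Bh (B ℕ.∸ Bh)
      (ℕP.≤-trans (ℕP.≤-reflexive (cong (Bh ℕ.+_) (sym (ℕP.+-identityʳ Bh))))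
                  (ℕP.≤-trans 2Bh≤B (ℕP.≤-reflexive (sym (ℕP.m+[n∸m]≡n Bh≤B)))))

  4≤K : 8 ℕ.≤ B → 4 ℕ.≤ B ℕ.∸ Bh
  4≤K 8≤B = ℕP.*-cancelˡ-≤ 2 (ℕP.≤-trans 8≤B
    (ℕP.≤-trans B≤2K (ℕP.≤-reflexive (cong ((B ℕ.∸ Bh) ℕ.+_) (sym (ℕP.+-identityʳ (B ℕ.∸ Bh)))))))

  K≤m : ∀ {m} → B ℕ.≤ Bh ℕ.+ m → B ℕ.∸ Bh ℕ.≤ m
  K≤m = ℕP.m≤n+o⇒m∸n≤o B Bh

1≤Bh : ∀ {c B Bh} → 0ℚ < c → 1 ℕ.≤ B → c * ι B ≤ ι Bh → 1 ℕ.≤ Bh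
1≤Bh {Bh = zero}  0<c 1≤B cB≤0 = ⊥-elim (<-irrefl refl (<-≤-trans (*-pos 0<c (ι-pos 1≤B)) cB≤0))
1≤Bh {Bh = suc _} _   _   _    = ℕ.s≤s ℕ.z≤n

scale-lower : ∀ B' {E} → ¼ ≤ ι (suc B') * E → ¼ * recip B' ≤ E
scale-lower B' {E} ¼≤BE = begin
  ¼ * recip B'                   ≤⟨ *-monoʳ-≤-nonNeg (recip B') {{nonNegative (<⇒≤ (recip-pos B'))}} ¼≤BE ⟩
  ι (suc B') * E * recip B'      ≡⟨ solve 3 (λ b e u → b :* e :* u := e :* (u :* b)) refl (ι (suc B')) E (recip B') ⟩
  E * (recip B' * ι (suc B'))    ≡⟨ trans (cong (E *_) (recip-ι B')) (*-identityʳ E) ⟩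
  E ∎
  where
  open ≤-Reasoning
  open +-*-Solver

scale-upper : ∀ B' {E C} → E * ι (suc B') ≤ C → E ≤ C * recip B'
scale-upper B' {E} {C} BE≤C = begin
  E                              ≡⟨ trans (sym (*-identityʳ E)) (cong (E *_) (sym (recip-ι B'))) ⟩
  E * (recip B' * ι (suc B'))    ≡⟨ solve 3 (λ e u b → e :* (u :* b) := (e :* b) :* u) refl E (recip B') (ι (suc B')) ⟩
  E * ι (suc B') * recip B'      ≤⟨ *-monoʳ-≤-nonNeg (recip B') {{nonNegative (<⇒≤ (recip-pos B'))}} BE≤C ⟩
  C * recip B' ∎
  where
  open ≤-Reasoning
  open +-*-Solver

rescale-upper : ∀ {E b k bh c} → 0ℚ ≤ b → 0ℚ ≤ bh →
  E * E * k * bh ≤ 1ℚ → c * b ≤ bh → b ≤ k + k → (E * b) * (E * b) * c ≤ 1ℚ + 1ℚ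
rescale-upper {E} {b} {k} {bh} {c} 0≤b 0≤bh E²kbh≤1 cb≤bh b≤2k = begin
  (E * b) * (E * b) * c       ≡⟨ solve 3 (λ e b c → (e :* b) :* (e :* b) :* c := e :* e :* b :* (c :* b)) refl E b c ⟩
  E * E * b * (c * b)         ≤⟨ *-monoˡ-≤-nonNeg (E * E * b) {{nonNegative (*-nonneg (sq-nonneg E) 0≤b)}} cb≤bh ⟩
  E * E * b * bh              ≡⟨ solve 3 (λ e b h → e :* e :* b :* h := e :* e :* h :* b) refl E b bh ⟩
  E * E * bh * b              ≤⟨ *-monoˡ-≤-nonNeg (E * E * bh) {{nonNegative (*-nonneg (sq-nonneg E) 0≤bh)}} b≤2k ⟩
  E * E * bh * (k + k)        ≡⟨ solve 3 (λ e h k → e :* e :* h :* (k :+ k) := (con 1ℚ :+ con 1ℚ) :* (e :* e :* k :* h)) refl E bh k ⟩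
  (1ℚ + 1ℚ) * (E * E * k * bh) ≤⟨ *-monoˡ-≤-nonNeg (1ℚ + 1ℚ) {{nonNegative (<⇒≤ (positive⁻¹ (1ℚ + 1ℚ)))}} E²kbh≤1 ⟩
  (1ℚ + 1ℚ) * 1ℚ              ≡⟨ *-identityʳ (1ℚ + 1ℚ) ⟩
  1ℚ + 1ℚ ∎
  where
  open ≤-Reasoning
  open +-*-Solver

-- The upper constant C₂ = 1 + 2/c, and the fact that x²c ≤ 2 implies x ≤ C₂
-- (as x² ≤ 2/c ≤ C₂ ≤ C₂²).
module UpperConstant (c : ℚ) (0<c : 0ℚ < c) where

  private instance
    c≢0 : Data.Rational.NonZero c
    c≢0 = >-nonZero 0<c

  1/c : ℚ
  1/c = 1/ c

  1/c≥0 : 0ℚ ≤ 1/c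
  1/c≥0 = <⇒≤ (positive⁻¹ 1/c {{1/pos⇒pos c {{positive 0<c}}}})

  C₂ : ℚ
  C₂ = 1ℚ + (1ℚ + 1ℚ) * 1/c

  2/c≥0 : 0ℚ ≤ (1ℚ + 1ℚ) * 1/c
  2/c≥0 = *-nonneg (<⇒≤ (positive⁻¹ (1ℚ + 1ℚ))) 1/c≥0

  C₂≥1 : 1ℚ ≤ C₂
  C₂≥1 = ≤-trans (≤-reflexive (sym (+-identityʳ 1ℚ))) (+-monoʳ-≤ 1ℚ 2/c≥0)

  C₂>0 : 0ℚ < C₂
  C₂>0 = <-≤-trans (positive⁻¹ 1ℚ) C₂≥1

  square-bound : ∀ x → x * x * c ≤ 1ℚ + 1ℚ → x ≤ C₂
  square-bound x x²c≤2 = sq-mono⁻¹ C₂>0 (begin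
    x * x                    ≡⟨ trans (sym (*-identityʳ (x * x))) (cong ((x * x) *_) (sym (*-inverseʳ c))) ⟩
    x * x * (c * 1/c)        ≡⟨ *-assoc (x * x) c 1/c ⟨
    x * x * c * 1/c          ≤⟨ *-monoʳ-≤-nonNeg 1/c {{nonNegative 1/c≥0}} x²c≤2 ⟩
    (1ℚ + 1ℚ) * 1/c          ≤⟨ ≤-trans (≤-reflexive (sym (+-identityˡ _))) (+-monoˡ-≤ ((1ℚ + 1ℚ) * 1/c) (<⇒≤ (positive⁻¹ 1ℚ))) ⟩
    C₂                       ≡⟨ *-identityʳ C₂ ⟨
    C₂ * 1ℚ                  ≤⟨ *-monoˡ-≤-nonNeg C₂ {{nonNegative (<⇒≤ C₂>0)}} C₂≥1 ⟩
    C₂ * C₂ ∎)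
    where open ≤-Reasoning

module _ (c : ℚ) (0<c : 0ℚ < c) where
  open UpperConstant c 0<c

  error-bounds : (B Bh m : ℕ) → .{{_ : NonZero B}} → 8 ℕ.≤ B → B ℕ.≤ Bh ℕ.+ m →
    c * ((+ B) / 1) ≤ (+ Bh) / 1 → 2 ℕ.* Bh ℕ.≤ B → (i : Fin m) →
    (¼ * ((+ 1) / B) ≤ expectedError B Bh m i) × (expectedError B Bh m i ≤ C₂ * ((+ 1) / B))
  error-bounds (suc B') Bh m 8≤B B≤Bh+m cB≤Bh 2Bh≤B i =
    scale-lower B' {E} (lower-bound Bh≤B (K≤m B≤Bh+m) (4≤K 8≤B)) , scale-upper B' (square-bound (E * ι B) [BE]²c≤2)
    where
    B = suc B'
    open ErrorAnalysis B Bh m i using (K; E; lower-bound; upper-bound)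
    open Parameters {B} {Bh} 2Bh≤B
    cB≤Bh' : c * ι B ≤ ι Bh
    cB≤Bh' = subst₂ (λ x y → c * x ≤ y) (fromℕ≡ι B) (fromℕ≡ι Bh) cB≤Bh
    1≤K : 1 ℕ.≤ K
    1≤K = ℕP.≤-trans (ℕ.s≤s ℕ.z≤n) (4≤K 8≤B)
    [BE]²c≤2 : (E * ι B) * (E * ι B) * c ≤ 1ℚ + 1ℚ
    [BE]²c≤2 = rescale-upper {E} {ι B} {ι K} {ι Bh} {c} (ι-nonneg B) (ι-nonneg Bh)
      (upper-bound (1≤Bh {B = B} 0<c (ℕ.s≤s ℕ.z≤n) cB≤Bh') 1≤K) cB≤Bh' (≤-trans (ι-mono B≤2K) (≤-reflexive (ι-+ K K)))

corollary5p2 :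
    (c : ℚ) → 0ℚ < c → c ≤ (+ 1) / 2 →
    Σ ℕ λ B₀ → Σ ℚ λ C₁ → Σ ℚ λ C₂ → 0ℚ < C₁ × 0ℚ < C₂ ×
      ((B Bh m : ℕ) → .{{_ : NonZero B}} → B₀ ℕ.≤ B →
        B ℕ.≤ Bh ℕ.+ m →
        c * ((+ B) / 1) ≤ (+ Bh) / 1 → 2 ℕ.* Bh ℕ.≤ B →
        (i : Fin m) →
          (C₁ * ((+ 1) / B) ≤ expectedError B Bh m i)
          × (expectedError B Bh m i ≤ C₂ * ((+ 1) / B)))
corollary5p2 c 0<c _ = 8 , ¼ , C₂ , positive⁻¹ ¼ , C₂>0 , error-bounds c 0<c
  where open UpperConstant c 0<c
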